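{- If $t$ is a term and $t\to t'$, then $t'$ is a term. Furthermore, if $t$ is a well-formed term and $t\to t'$, then $t'$ is well-formed.
   Context: Pseudo-terms are given by the grammar $t ::= x \mid \lambda x.t \mid (t\,t') \mid\, !t \mid \mathrm{let}\ t\ \mathrm{be}\ !x\ \mathrm{in}\ t'$. In $\mathrm{let}\ u\ \mathrm{be}\ !x\ \mathrm{in}\ t_1$ the variable $x$ is bound in $t_1$: $FV(\mathrm{let}\ u\ \mathrm{be}\ !x\ \mathrm{in}\ t_1)=FV(u)\cup(FV(t_1)\setminus\{x\})$; $\lambda$ binds as usual. $FV(t)$ is the set of free variables of $t$, and $no(x,t)$ is the number of free occurrences of $x$ in $t$. Terms and their sets of temporary variables $TV(t)\subseteq FV(t)$ are defined simultaneously as the smallest set of pseudo-terms such that: (i) a variable $x$ is a term, $TV(x)=\emptyset$; (ii) $\lambda x.t$ is a term iff $t$ is a term, $x\notin TV(t)$ and $no(x,t)\le 1$, and then $TV(\lambda x.t)=TV(t)$; (iii) $(t_1\,t_2)$ is a term iff $t_1,t_2$ are terms, $TV(t_1)\cap FV(t_2)=\emptyset$ and $FV(t_1)\cap TV(t_2)=\emptyset$, and then $TV(t_1\,t_2)=TV(t_1)\cup TV(t_2)$; (iv) $!t$ is a term iff $t$ is a term, $TV(t)=\emptyset$ and $no(x,t)=1$ for all $x\in FV(t)$, and then $TV(!t)=FV(t)$; (v) $\mathrm{let}\ t_1\ \mathrm{be}\ !x\ \mathrm{in}\ t_2$ is a term iff $t_1,t_2$ are terms, $TV(t_1)\cap FV(t_2)=\emptyset$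 and $FV(t_1)\cap TV(t_2)=\emptyset$, and then its $TV$ is $TV(t_1)\cup(TV(t_2)\setminus\{x\})$. A term $t$ is well-formed if $TV(t)=\emptyset$ and $no(x,t)=1$ for every $x\in FV(t)$. One-step reduction $\to$ is the contextual closure of the rules: $(\beta)$ $((\lambda x.t)\,u)\to t[u/x]$; (bang) $\mathrm{let}\ !u\ \mathrm{be}\ !x\ \mathrm{in}\ t\to t[u/x]$; (com1) $\mathrm{let}\ (\mathrm{let}\ t_1\ \mathrm{be}\ !y\ \mathrm{in}\ t_2)\ \mathrm{be}\ !x\ \mathrm{in}\ t_3 \to \mathrm{let}\ t_1\ \mathrm{be}\ !y\ \mathrm{in}\ (\mathrm{let}\ t_2\ \mathrm{be}\ !x\ \mathrm{in}\ t_3)$; (com2) $((\mathrm{let}\ t_1\ \mathrm{be}\ !x\ \mathrm{in}\ t_2)\ t_3)\to \mathrm{let}\ t_1\ \mathrm{be}\ !x\ \mathrm{in}\ (t_2\,t_3)$. Here $t[u/x]$ denotes capture-avoiding substitution. -}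

module Defs where

open import Data.Nat using (ℕ; zero; suc; _+_; _≤_; _≡ᵇ_)
open import Data.Product using (_×_)
open import Data.Empty using (⊥)
open import Relation.Nullary using (¬_)
open import Relation.Binary.PropositionalEquality using (_≡_)
open import Data.Bool using (if_then_else_)

-- Pseudo-terms, in de Bruijn representation (terms up to α-equivalence).
--   lam t      = λx.t           (x is index 0 in t)
--   letb u t   = let u be !x in t  (x is index 0 in t, not bound in u)
data Tm : Set where
  var  : ℕ → Tm
  lam  : Tm → Tm
  app  : Tm → Tm → Tm
  bang : Tm → Tm
  letb : Tm → Tm → Tm

no : ℕ → Tm → ℕ
no x (var y) = if x ≡ᵇ y then 1 else 0
no x (lam t)    = no (suc x) t
no x (app t u)  = no x t + no x u
no x (bang t)   = no x t
no x (letb u t) = no x u + no (suc x) t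

data _∈FV_ : ℕ → Tm → Set where
  fv-var  : ∀ {x} → x ∈FV var x
  fv-lam  : ∀ {x t} → suc x ∈FV t → x ∈FV lam t
  fv-app₁ : ∀ {x t u} → x ∈FV t → x ∈FV app t u
  fv-app₂ : ∀ {x t u} → x ∈FV u → x ∈FV app t u
  fv-bang : ∀ {x t} → x ∈FV t → x ∈FV bang t
  fv-let₁ : ∀ {x u t} → x ∈FV u → x ∈FV letb u t
  fv-let₂ : ∀ {x u t} → suc x ∈FV t → x ∈FV letb u t

data _∈TV_ : ℕ → Tm → Set where
  tv-lam  : ∀ {x t} → suc x ∈TV t → x ∈TV lam t
  tv-app₁ : ∀ {x t u} → x ∈TV t → x ∈TV app t u
  tv-app₂ : ∀ {x t u} → x ∈TV u → x ∈TV app t u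
  tv-bang : ∀ {x t} → x ∈FV t → x ∈TV bang t
  tv-let₁ : ∀ {x u t} → x ∈TV u → x ∈TV letb u t
  tv-let₂ : ∀ {x u t} → suc x ∈TV t → x ∈TV letb u t

Compatible : Tm → Tm → Set
Compatible t u = (∀ x → x ∈TV t → ¬ (x ∈FV u)) × (∀ x → x ∈FV t → ¬ (x ∈TV u))

data IsTerm : Tm → Set where
  t-var  : ∀ {x} → IsTerm (var x)
  t-lam  : ∀ {t} → IsTerm t → ¬ (0 ∈TV t) → no 0 t ≤ 1 → IsTerm (lam t)
  t-app  : ∀ {t u} → IsTerm t → IsTerm u → Compatible t u → IsTerm (app t u)
  t-bang : ∀ {t} → IsTerm t → (∀ x → ¬ (x ∈TV t)) → (∀ x → x ∈FV t → no x t ≡ 1)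
         → IsTerm (bang t)
  t-let  : ∀ {u t} → IsTerm u → IsTerm t → Compatible u (lam t) → IsTerm (letb u t)

-- Note: in t-let, FV(t₂) for the named term corresponds to FV(lam t) here
-- (the bound variable x removed); since x ∉ FV(t₁) by the variable convention,
-- the side conditions TV(t₁)∩FV(t₂)=∅ and FV(t₁)∩TV(t₂)=∅ are exactly these.

WellFormed : Tm → Set
WellFormed t = IsTerm t × (∀ x → ¬ (x ∈TV t)) × (∀ x → x ∈FV t → no x t ≡ 1)

ext : (ℕ → ℕ) → ℕ → ℕ
ext ρ zero    = zero
ext ρ (suc n) = suc (ρ n)

rename : (ℕ → ℕ) → Tm → Tm
rename ρ (var x)    = var (ρ x)
rename ρ (lam t)    = lam (rename (ext ρ) t)
rename ρ (app t u)  = app (rename ρ t) (rename ρ u)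
rename ρ (bang t)   = bang (rename ρ t)
rename ρ (letb u t) = letb (rename ρ u) (rename (ext ρ) t)

exts : (ℕ → Tm) → ℕ → Tm
exts σ zero    = var zero
exts σ (suc n) = rename suc (σ n)

subst : (ℕ → Tm) → Tm → Tm
subst σ (var x)    = σ x
subst σ (lam t)    = lam (subst (exts σ) t)
subst σ (app t u)  = app (subst σ t) (subst σ u)
subst σ (bang t)   = bang (subst σ t)
subst σ (letb u t) = letb (subst σ u) (subst (exts σ) t)

sub0 : Tm → ℕ → Tm
sub0 u zero    = u
sub0 u (suc n) = var n

_[_] : Tm → Tm → Tm
t [ u ] = subst (sub0 u) t

infix 4 _⟶_
data _⟶_ : Tm → Tm → Set where
  β     : ∀ {t u} → app (lam t) u ⟶ t [ u ]
  bangR : ∀ {u t} → letb (bang u) t ⟶ t [ u ]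
  com1  : ∀ {t₁ t₂ t₃} → letb (letb t₁ t₂) t₃ ⟶ letb t₁ (letb t₂ (rename (ext suc) t₃))
  com2  : ∀ {t₁ t₂ t₃} → app (letb t₁ t₂) t₃ ⟶ letb t₁ (app t₂ (rename suc t₃))
  c-lam  : ∀ {t t'} → t ⟶ t' → lam t ⟶ lam t'
  c-app₁ : ∀ {t t' u} → t ⟶ t' → app t u ⟶ app t' u
  c-app₂ : ∀ {t u u'} → u ⟶ u' → app t u ⟶ app t u'
  c-bang : ∀ {t t'} → t ⟶ t' → bang t ⟶ bang t'
  c-let₁ : ∀ {u u' t} → u ⟶ u' → letb u t ⟶ letb u' t
  c-let₂ : ∀ {u t t'} → t ⟶ t' → letb u t ⟶ letb u t'

-- Reduction never creates free or temporary variables, and never increases the number of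
-- occurrences of a variable that is not temporary; hence every side condition of the term
-- formation rules that held before a step still holds after it.  The real work is the
-- substitution performed by β and by the !-rule: simultaneous substitution preserves terms
-- as long as it is admissible (images of temporary variables are boxable, and no variable of
-- an image collides with a temporary variable elsewhere), and both redexes yield admissible
-- substitutions.
module Submission where

open import Defs
open import Data.Empty using (⊥; ⊥-elim)
open import Data.Nat using (ℕ; zero; suc; _+_; _*_; _≤_; z≤n; _≟_)
open import Data.Nat.Properties
open import Data.Nat.Solver using (module +-*-Solver)
open import Data.Product using (_×_; _,_; proj₁; proj₂; ∃-syntax)
open import Data.Sum using (_⊎_; inj₁; inj₂)
open import Function using (_∘_)
open import Function.Definitions using (Injective)
open import Relation.Nullary using (¬_; yes) renaming (no to no′)
open import Relation.Binary.PropositionalEquality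
  using (_≡_; _≢_; refl; sym; trans; cong; cong₂; module ≡-Reasoning)

no-var-≡ : ∀ x → no x (var x) ≡ 1
no-var-≡ zero    = refl
no-var-≡ (suc x) = no-var-≡ x

no-var-≢ : ∀ {x y} → x ≢ y → no x (var y) ≡ 0
no-var-≢ {zero}  {zero}  x≢y = ⊥-elim (x≢y refl)
no-var-≢ {zero}  {suc y} x≢y = refl
no-var-≢ {suc x} {zero}  x≢y = refl
no-var-≢ {suc x} {suc y} x≢y = no-var-≢ (x≢y ∘ cong suc)

∉FV⇒no≡0 : ∀ t {x} → ¬ (x ∈FV t) → no x t ≡ 0
∉FV⇒no≡0 (var y) {x} x∉ with x ≟ y
... | yes refl = ⊥-elim (x∉ fv-var)
... | no′ x≢y  = no-var-≢ x≢y
∉FV⇒no≡0 (lam t)    x∉ = ∉FV⇒no≡0 t (x∉ ∘ fv-lam)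
∉FV⇒no≡0 (app t u)  x∉ = cong₂ _+_ (∉FV⇒no≡0 t (x∉ ∘ fv-app₁)) (∉FV⇒no≡0 u (x∉ ∘ fv-app₂))
∉FV⇒no≡0 (bang t)   x∉ = ∉FV⇒no≡0 t (x∉ ∘ fv-bang)
∉FV⇒no≡0 (letb u t) x∉ = cong₂ _+_ (∉FV⇒no≡0 u (x∉ ∘ fv-let₁)) (∉FV⇒no≡0 t (x∉ ∘ fv-let₂))

∈FV⇒no≥1 : ∀ {x t} → x ∈FV t → 1 ≤ no x t
∈FV⇒no≥1 {x} fv-var = ≤-reflexive (sym (no-var-≡ x))
∈FV⇒no≥1 (fv-lam p)  = ∈FV⇒no≥1 p
∈FV⇒no≥1 (fv-app₁ p) = ≤-trans (∈FV⇒no≥1 p) (m≤m+n _ _)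
∈FV⇒no≥1 (fv-app₂ p) = ≤-trans (∈FV⇒no≥1 p) (m≤n+m _ _)
∈FV⇒no≥1 (fv-bang p) = ∈FV⇒no≥1 p
∈FV⇒no≥1 (fv-let₁ p) = ≤-trans (∈FV⇒no≥1 p) (m≤m+n _ _)
∈FV⇒no≥1 (fv-let₂ p) = ≤-trans (∈FV⇒no≥1 p) (m≤n+m _ _)

∈FV-both⇒no≥2 : ∀ {x s t} → x ∈FV s → x ∈FV t → 2 ≤ no x (app s t)
∈FV-both⇒no≥2 p q = +-mono-≤ (∈FV⇒no≥1 p) (∈FV⇒no≥1 q)

∈TV⇒∈FV : ∀ {x t} → x ∈TV t → x ∈FV t
∈TV⇒∈FV (tv-lam p)  = fv-lam (∈TV⇒∈FV p)
∈TV⇒∈FV (tv-app₁ p) = fv-app₁ (∈TV⇒∈FV p)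
∈TV⇒∈FV (tv-app₂ p) = fv-app₂ (∈TV⇒∈FV p)
∈TV⇒∈FV (tv-bang p) = fv-bang p
∈TV⇒∈FV (tv-let₁ p) = fv-let₁ (∈TV⇒∈FV p)
∈TV⇒∈FV (tv-let₂ p) = fv-let₂ (∈TV⇒∈FV p)

-- The side condition of t-bang; WellFormed t is definitionally IsTerm t × Boxable t.
Boxable : Tm → Set
Boxable t = (∀ x → ¬ (x ∈TV t)) × (∀ x → x ∈FV t → no x t ≡ 1)

Boxable-var : ∀ y → Boxable (var y)
Boxable-var y = (λ _ ()) , λ { x fv-var → no-var-≡ x }

IsTerm-bang : ∀ {t} → IsTerm t → Boxable t → IsTerm (bang t)
IsTerm-bang ⊢t (no-tv , linear) = t-bang ⊢t no-tv linear

-- Renaming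

ext-injective : ∀ {ρ} → Injective _≡_ _≡_ ρ → Injective _≡_ _≡_ (ext ρ)
ext-injective ρ-inj {zero}  {zero}  _ = refl
ext-injective ρ-inj {suc a} {suc b} e = cong suc (ρ-inj (suc-injective e))

ext-suc-injective : Injective _≡_ _≡_ (ext suc)
ext-suc-injective = ext-injective suc-injective

∈FV-rename⁻ : ∀ ρ t {x} → x ∈FV rename ρ t → ∃[ y ] y ∈FV t × x ≡ ρ y
∈FV-rename⁻ ρ (var y) fv-var = y , fv-var , refl
∈FV-rename⁻ ρ (lam t) (fv-lam p) with ∈FV-rename⁻ (ext ρ) t p
... | suc y , q , e = y , fv-lam q , suc-injective e
∈FV-rename⁻ ρ (app t u) (fv-app₁ p) with ∈FV-rename⁻ ρ t p
... | y , q , e = y , fv-app₁ q , e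
∈FV-rename⁻ ρ (app t u) (fv-app₂ p) with ∈FV-rename⁻ ρ u p
... | y , q , e = y , fv-app₂ q , e
∈FV-rename⁻ ρ (bang t) (fv-bang p) with ∈FV-rename⁻ ρ t p
... | y , q , e = y , fv-bang q , e
∈FV-rename⁻ ρ (letb u t) (fv-let₁ p) with ∈FV-rename⁻ ρ u p
... | y , q , e = y , fv-let₁ q , e
∈FV-rename⁻ ρ (letb u t) (fv-let₂ p) with ∈FV-rename⁻ (ext ρ) t p
... | suc y , q , e = y , fv-let₂ q , suc-injective e

∈TV-rename⁻ : ∀ ρ t {x} → x ∈TV rename ρ t → ∃[ y ] y ∈TV t × x ≡ ρ y
∈TV-rename⁻ ρ (lam t) (tv-lam p) with ∈TV-rename⁻ (ext ρ) t p
... | suc y , q , e = y , tv-lam q , suc-injective e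
∈TV-rename⁻ ρ (app t u) (tv-app₁ p) with ∈TV-rename⁻ ρ t p
... | y , q , e = y , tv-app₁ q , e
∈TV-rename⁻ ρ (app t u) (tv-app₂ p) with ∈TV-rename⁻ ρ u p
... | y , q , e = y , tv-app₂ q , e
∈TV-rename⁻ ρ (bang t) (tv-bang p) with ∈FV-rename⁻ ρ t p
... | y , q , e = y , tv-bang q , e
∈TV-rename⁻ ρ (letb u t) (tv-let₁ p) with ∈TV-rename⁻ ρ u p
... | y , q , e = y , tv-let₁ q , e
∈TV-rename⁻ ρ (letb u t) (tv-let₂ p) with ∈TV-rename⁻ (ext ρ) t p
... | suc y , q , e = y , tv-let₂ q , suc-injective e

∈FV-rename-injective⁻ : ∀ {ρ} → Injective _≡_ _≡_ ρ → ∀ t {x} → ρ x ∈FV rename ρ t → x ∈FV t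
∈FV-rename-injective⁻ {ρ} ρ-inj t p with ∈FV-rename⁻ ρ t p
... | y , q , e rewrite ρ-inj e = q

∈TV-rename-injective⁻ : ∀ {ρ} → Injective _≡_ _≡_ ρ → ∀ t {x} → ρ x ∈TV rename ρ t → x ∈TV t
∈TV-rename-injective⁻ {ρ} ρ-inj t p with ∈TV-rename⁻ ρ t p
... | y , q , e rewrite ρ-inj e = q

∈FV-weaken⁻ : ∀ t {x} → suc x ∈FV rename suc t → x ∈FV t
∈FV-weaken⁻ = ∈FV-rename-injective⁻ suc-injective

∈TV-weaken⁻ : ∀ t {x} → suc x ∈TV rename suc t → x ∈TV t
∈TV-weaken⁻ = ∈TV-rename-injective⁻ suc-injective

0∉FV-weaken : ∀ t → ¬ (0 ∈FV rename suc t)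
0∉FV-weaken t p with ∈FV-rename⁻ suc t p
... | _ , _ , ()

0∉TV-weaken : ∀ t → ¬ (0 ∈TV rename suc t)
0∉TV-weaken t = 0∉FV-weaken t ∘ ∈TV⇒∈FV

no-rename : ∀ {ρ} → Injective _≡_ _≡_ ρ → ∀ t x → no (ρ x) (rename ρ t) ≡ no x t
no-rename {ρ} ρ-inj (var y) x with x ≟ y
... | yes refl = trans (no-var-≡ (ρ x)) (sym (no-var-≡ x))
... | no′ x≢y  = trans (no-var-≢ (x≢y ∘ ρ-inj)) (sym (no-var-≢ x≢y))
no-rename ρ-inj (lam t)    x = no-rename (ext-injective ρ-inj) t (suc x)
no-rename ρ-inj (app t u)  x = cong₂ _+_ (no-rename ρ-inj t x) (no-rename ρ-inj u x)
no-rename ρ-inj (bang t)   x = no-rename ρ-inj t x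
no-rename ρ-inj (letb u t) x =
  cong₂ _+_ (no-rename ρ-inj u x) (no-rename (ext-injective ρ-inj) t (suc x))

no-weaken : ∀ t x → no (suc x) (rename suc t) ≡ no x t
no-weaken = no-rename suc-injective

Compatible-rename : ∀ {ρ} → Injective _≡_ _≡_ ρ → ∀ {s t} → Compatible s t
                  → Compatible (rename ρ s) (rename ρ t)
Compatible-rename {ρ} ρ-inj {s} {t} (tv∩fv , fv∩tv) = tv∩fv′ , fv∩tv′
  where
  tv∩fv′ : ∀ x → x ∈TV rename ρ s → ¬ (x ∈FV rename ρ t)
  tv∩fv′ x p q with ∈TV-rename⁻ ρ s p
  ... | y , y∈ , refl = tv∩fv y y∈ (∈FV-rename-injective⁻ ρ-inj t q)
  fv∩tv′ : ∀ x → x ∈FV rename ρ s → ¬ (x ∈TV rename ρ t)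
  fv∩tv′ x p q with ∈FV-rename⁻ ρ s p
  ... | y , y∈ , refl = fv∩tv y y∈ (∈TV-rename-injective⁻ ρ-inj t q)

Boxable-rename : ∀ {ρ} → Injective _≡_ _≡_ ρ → ∀ {t} → Boxable t → Boxable (rename ρ t)
Boxable-rename {ρ} ρ-inj {t} (no-tv , linear) = no-tv′ , linear′
  where
  no-tv′ : ∀ x → ¬ (x ∈TV rename ρ t)
  no-tv′ x p with ∈TV-rename⁻ ρ t p
  ... | y , y∈ , _ = no-tv y y∈
  linear′ : ∀ x → x ∈FV rename ρ t → no x (rename ρ t) ≡ 1
  linear′ x p with ∈FV-rename⁻ ρ t p
  ... | y , y∈ , refl = trans (no-rename ρ-inj t y) (linear y y∈)

IsTerm-rename : ∀ {ρ} → Injective _≡_ _≡_ ρ → ∀ {t} → IsTerm t → IsTerm (rename ρ t)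
IsTerm-rename ρ-inj t-var = t-var
IsTerm-rename {ρ} ρ-inj {lam t} (t-lam ⊢t 0∉TV no≤1) =
  t-lam (IsTerm-rename ext-inj ⊢t)
        (0∉TV ∘ ∈TV-rename-injective⁻ ext-inj t {0})
        (≤-trans (≤-reflexive (no-rename ext-inj t 0)) no≤1)
  where
  ext-inj : Injective _≡_ _≡_ (ext ρ)
  ext-inj = ext-injective ρ-inj
IsTerm-rename ρ-inj (t-app ⊢s ⊢t c) =
  t-app (IsTerm-rename ρ-inj ⊢s) (IsTerm-rename ρ-inj ⊢t) (Compatible-rename ρ-inj c)
IsTerm-rename ρ-inj (t-bang ⊢t no-tv linear) =
  IsTerm-bang (IsTerm-rename ρ-inj ⊢t) (Boxable-rename ρ-inj (no-tv , linear))
IsTerm-rename ρ-inj (t-let ⊢u ⊢t c) =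
  t-let (IsTerm-rename ρ-inj ⊢u) (IsTerm-rename (ext-injective ρ-inj) ⊢t)
        (Compatible-rename ρ-inj c)

record _⊆ᵥ_ (s t : Tm) : Set where
  field
    ⊆FV : ∀ {x} → x ∈FV s → x ∈FV t
    ⊆TV : ∀ {x} → x ∈TV s → x ∈TV t
open _⊆ᵥ_

⊆ᵥ-refl : ∀ {t} → t ⊆ᵥ t
⊆ᵥ-refl = record { ⊆FV = λ p → p ; ⊆TV = λ p → p }

⊆ᵥ-lam : ∀ {s t} → s ⊆ᵥ t → lam s ⊆ᵥ lam t
⊆ᵥ-lam s⊆t = record { ⊆FV = λ { (fv-lam p) → fv-lam (⊆FV s⊆t p) }
                    ; ⊆TV = λ { (tv-lam p) → tv-lam (⊆TV s⊆t p) } }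

⊆ᵥ-app₁ : ∀ {s t} → s ⊆ᵥ app s t
⊆ᵥ-app₁ = record { ⊆FV = fv-app₁ ; ⊆TV = tv-app₁ }

⊆ᵥ-app₂ : ∀ {s t} → t ⊆ᵥ app s t
⊆ᵥ-app₂ = record { ⊆FV = fv-app₂ ; ⊆TV = tv-app₂ }

⊆ᵥ-app-swap : ∀ {s t} → app t s ⊆ᵥ app s t
⊆ᵥ-app-swap = record { ⊆FV = λ { (fv-app₁ p) → fv-app₂ p ; (fv-app₂ p) → fv-app₁ p }
                     ; ⊆TV = λ { (tv-app₁ p) → tv-app₂ p ; (tv-app₂ p) → tv-app₁ p } }

⊆ᵥ-bang : ∀ {t} → t ⊆ᵥ bang t
⊆ᵥ-bang = record { ⊆FV = fv-bang ; ⊆TV = tv-bang ∘ ∈TV⇒∈FV }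

⊆ᵥ-let₁ : ∀ {u t} → u ⊆ᵥ letb u t
⊆ᵥ-let₁ = record { ⊆FV = fv-let₁ ; ⊆TV = tv-let₁ }

⊆ᵥ-let₂ : ∀ {u t} → lam t ⊆ᵥ letb u t
⊆ᵥ-let₂ = record { ⊆FV = λ { (fv-lam p) → fv-let₂ p } ; ⊆TV = λ { (tv-lam p) → tv-let₂ p } }

⊆ᵥ-let-app : ∀ {u t} → app u (lam t) ⊆ᵥ letb u t
⊆ᵥ-let-app = record { ⊆FV = λ { (fv-app₁ p) → fv-let₁ p ; (fv-app₂ (fv-lam p)) → fv-let₂ p }
                    ; ⊆TV = λ { (tv-app₁ p) → tv-let₁ p ; (tv-app₂ (tv-lam p)) → tv-let₂ p } }

⊆ᵥ-com1 : ∀ {t₂ t₃} → lam (letb t₂ (rename (ext suc) t₃)) ⊆ᵥ app (lam t₂) (lam t₃)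
⊆ᵥ-com1 {t₃ = t₃} = record
  { ⊆FV = λ { (fv-lam (fv-let₁ p)) → fv-app₁ (fv-lam p)
            ; (fv-lam (fv-let₂ p)) → fv-app₂ (fv-lam (∈FV-rename-injective⁻ ext-suc-injective t₃ p)) }
  ; ⊆TV = λ { (tv-lam (tv-let₁ p)) → tv-app₁ (tv-lam p)
            ; (tv-lam (tv-let₂ p)) → tv-app₂ (tv-lam (∈TV-rename-injective⁻ ext-suc-injective t₃ p)) }
  }

⊆ᵥ-com2 : ∀ {t₂ t₃} → lam (app t₂ (rename suc t₃)) ⊆ᵥ app (lam t₂) t₃
⊆ᵥ-com2 {t₃ = t₃} = record
  { ⊆FV = λ { (fv-lam (fv-app₁ p)) → fv-app₁ (fv-lam p)
            ; (fv-lam (fv-app₂ p)) → fv-app₂ (∈FV-weaken⁻ t₃ p) }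
  ; ⊆TV = λ { (tv-lam (tv-app₁ p)) → tv-app₁ (tv-lam p)
            ; (tv-lam (tv-app₂ p)) → tv-app₂ (∈TV-weaken⁻ t₃ p) }
  }

Compatible-sym : ∀ {s t} → Compatible s t → Compatible t s
Compatible-sym (tv∩fv , fv∩tv) = (λ x p q → fv∩tv x q p) , (λ x p q → tv∩fv x q p)

Compatible-mono : ∀ {s s′ t t′} → s ⊆ᵥ s′ → t ⊆ᵥ t′ → Compatible s′ t′ → Compatible s t
Compatible-mono s⊆ t⊆ (tv∩fv , fv∩tv) =
  (λ x p q → tv∩fv x (⊆TV s⊆ p) (⊆FV t⊆ q)) , (λ x p q → fv∩tv x (⊆FV s⊆ p) (⊆TV t⊆ q))

Compatible-app : ∀ {s t u} → Compatible s t → Compatible s u → Compatible s (app t u)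
Compatible-app (tv∩fv , fv∩tv) (tv∩fv′ , fv∩tv′) =
  (λ { x p (fv-app₁ q) → tv∩fv x p q ; x p (fv-app₂ q) → tv∩fv′ x p q })
  , (λ { x p (tv-app₁ q) → fv∩tv x p q ; x p (tv-app₂ q) → fv∩tv′ x p q })

Compatible-weaken : ∀ {s t} → Compatible (lam s) t → Compatible s (rename suc t)
Compatible-weaken {s} {t} (tv∩fv , fv∩tv) = tv∩fv′ , fv∩tv′
  where
  tv∩fv′ : ∀ x → x ∈TV s → ¬ (x ∈FV rename suc t)
  tv∩fv′ x p q with ∈FV-rename⁻ suc t q
  ... | y , y∈ , refl = tv∩fv y (tv-lam p) y∈
  fv∩tv′ : ∀ x → x ∈FV s → ¬ (x ∈TV rename suc t)
  fv∩tv′ x p q with ∈TV-rename⁻ suc t q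
  ... | y , y∈ , refl = fv∩tv y (fv-lam p) y∈

-- Substitution

∈FV-subst⁻ : ∀ σ t {x} → x ∈FV subst σ t → ∃[ y ] y ∈FV t × x ∈FV σ y
∈FV-subst⁻ σ (var y) p = y , fv-var , p
∈FV-subst⁻ σ (lam t) (fv-lam p) with ∈FV-subst⁻ (exts σ) t p
... | suc y , y∈ , q = y , fv-lam y∈ , ∈FV-weaken⁻ (σ y) q
∈FV-subst⁻ σ (app t u) (fv-app₁ p) with ∈FV-subst⁻ σ t p
... | y , y∈ , q = y , fv-app₁ y∈ , q
∈FV-subst⁻ σ (app t u) (fv-app₂ p) with ∈FV-subst⁻ σ u p
... | y , y∈ , q = y , fv-app₂ y∈ , q
∈FV-subst⁻ σ (bang t) (fv-bang p) with ∈FV-subst⁻ σ t p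
... | y , y∈ , q = y , fv-bang y∈ , q
∈FV-subst⁻ σ (letb u t) (fv-let₁ p) with ∈FV-subst⁻ σ u p
... | y , y∈ , q = y , fv-let₁ y∈ , q
∈FV-subst⁻ σ (letb u t) (fv-let₂ p) with ∈FV-subst⁻ (exts σ) t p
... | suc y , y∈ , q = y , fv-let₂ y∈ , ∈FV-weaken⁻ (σ y) q

∈TV-subst⁻ : ∀ σ t {x} → x ∈TV subst σ t
           → (∃[ y ] y ∈TV t × x ∈FV σ y) ⊎ (∃[ y ] y ∈FV t × x ∈TV σ y)
∈TV-subst⁻ σ (var y) p = inj₂ (y , fv-var , p)
∈TV-subst⁻ σ (lam t) (tv-lam p) with ∈TV-subst⁻ (exts σ) t p
... | inj₁ (suc y , y∈ , q) = inj₁ (y , tv-lam y∈ , ∈FV-weaken⁻ (σ y) q)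
... | inj₂ (suc y , y∈ , q) = inj₂ (y , fv-lam y∈ , ∈TV-weaken⁻ (σ y) q)
∈TV-subst⁻ σ (app t u) (tv-app₁ p) with ∈TV-subst⁻ σ t p
... | inj₁ (y , y∈ , q) = inj₁ (y , tv-app₁ y∈ , q)
... | inj₂ (y , y∈ , q) = inj₂ (y , fv-app₁ y∈ , q)
∈TV-subst⁻ σ (app t u) (tv-app₂ p) with ∈TV-subst⁻ σ u p
... | inj₁ (y , y∈ , q) = inj₁ (y , tv-app₂ y∈ , q)
... | inj₂ (y , y∈ , q) = inj₂ (y , fv-app₂ y∈ , q)
∈TV-subst⁻ σ (bang t) (tv-bang p) with ∈FV-subst⁻ σ t p
... | y , y∈ , q = inj₁ (y , tv-bang y∈ , q)
∈TV-subst⁻ σ (letb u t) (tv-let₁ p) with ∈TV-subst⁻ σ u p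
... | inj₁ (y , y∈ , q) = inj₁ (y , tv-let₁ y∈ , q)
... | inj₂ (y , y∈ , q) = inj₂ (y , fv-let₁ y∈ , q)
∈TV-subst⁻ σ (letb u t) (tv-let₂ p) with ∈TV-subst⁻ (exts σ) t p
... | inj₁ (suc y , y∈ , q) = inj₁ (y , tv-let₂ y∈ , ∈FV-weaken⁻ (σ y) q)
... | inj₂ (suc y , y∈ , q) = inj₂ (y , fv-let₂ y∈ , ∈TV-weaken⁻ (σ y) q)

apart-exts : ∀ σ t {x a} → (∀ {y} → y ∈FV lam t → y ≢ a → ¬ (x ∈FV σ y))
           → ∀ {y} → y ∈FV t → y ≢ suc a → ¬ (suc x ∈FV exts σ y)
apart-exts σ t h {zero}  _ _ ()
apart-exts σ t h {suc y} p y≢ q = h (fv-lam p) (y≢ ∘ cong suc) (∈FV-weaken⁻ (σ y) q)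

no-subst-single : ∀ σ t {x} a → (∀ {y} → y ∈FV t → y ≢ a → ¬ (x ∈FV σ y))
                → no x (subst σ t) ≡ no a t * no x (σ a)
no-subst-single σ (var y) {x} a h with y ≟ a
... | yes refl = sym (trans (cong (_* no x (σ y)) (no-var-≡ y)) (*-identityˡ _))
... | no′ y≢a  = trans (∉FV⇒no≡0 (σ y) (h fv-var y≢a))
                       (sym (cong (_* no x (σ a)) (no-var-≢ (y≢a ∘ sym))))
no-subst-single σ (lam t) {x} a h =
  trans (no-subst-single (exts σ) t (suc a) (apart-exts σ t h))
        (cong (no (suc a) t *_) (no-weaken (σ a) x))
no-subst-single σ (app t u) {x} a h =
  trans (cong₂ _+_ (no-subst-single σ t a (h ∘ fv-app₁)) (no-subst-single σ u a (h ∘ fv-app₂)))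
        (sym (*-distribʳ-+ (no x (σ a)) (no a t) (no a u)))
no-subst-single σ (bang t) a h = no-subst-single σ t a (h ∘ fv-bang)
no-subst-single σ (letb u t) {x} a h =
  trans (cong₂ _+_ (no-subst-single σ u a (h ∘ fv-let₁))
                   (trans (no-subst-single (exts σ) t (suc a) (apart-exts σ t (h ∘ ⊆FV ⊆ᵥ-let₂)))
                          (cong (no (suc a) t *_) (no-weaken (σ a) x))))
        (sym (*-distribʳ-+ (no x (σ a)) (no a u) (no (suc a) t)))

apart₂-exts : ∀ σ {x a b} → (∀ {y} → y ≢ a → y ≢ b → ¬ (x ∈FV σ y))
            → ∀ {y} → y ≢ suc a → y ≢ suc b → ¬ (suc x ∈FV exts σ y)
apart₂-exts σ h {zero}  _ _ ()
apart₂-exts σ h {suc y} y≢a y≢b q = h (y≢a ∘ cong suc) (y≢b ∘ cong suc) (∈FV-weaken⁻ (σ y) q)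

+-*-collect : ∀ m₁ m₂ n₁ n₂ c d
            → (m₁ * c + n₁ * d) + (m₂ * c + n₂ * d) ≡ (m₁ + m₂) * c + (n₁ + n₂) * d
+-*-collect = solve 6 (λ m₁ m₂ n₁ n₂ c d → (m₁ :* c :+ n₁ :* d) :+ (m₂ :* c :+ n₂ :* d)
                                         := (m₁ :+ m₂) :* c :+ (n₁ :+ n₂) :* d) refl
  where open +-*-Solver

no-subst-pair : ∀ σ t {x} a b → a ≢ b → (∀ {y} → y ≢ a → y ≢ b → ¬ (x ∈FV σ y))
              → no x (subst σ t) ≡ no a t * no x (σ a) + no b t * no x (σ b)
no-subst-pair σ (var y) {x} a b a≢b h with y ≟ a | y ≟ b
... | yes refl | _
  rewrite no-var-≡ y | no-var-≢ (a≢b ∘ sym) = sym (trans (+-identityʳ _) (+-identityʳ _))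
... | no′ y≢a | yes refl
  rewrite no-var-≡ y | no-var-≢ a≢b = sym (+-identityʳ _)
... | no′ y≢a | no′ y≢b
  rewrite no-var-≢ (y≢a ∘ sym) | no-var-≢ (y≢b ∘ sym) = ∉FV⇒no≡0 (σ y) (h y≢a y≢b)
no-subst-pair σ (lam t) {x} a b a≢b h =
  trans (no-subst-pair (exts σ) t (suc a) (suc b) (a≢b ∘ suc-injective) (apart₂-exts σ h))
        (cong₂ _+_ (cong (no (suc a) t *_) (no-weaken (σ a) x))
                   (cong (no (suc b) t *_) (no-weaken (σ b) x)))
no-subst-pair σ (app t u) a b a≢b h =
  trans (cong₂ _+_ (no-subst-pair σ t a b a≢b h) (no-subst-pair σ u a b a≢b h))
        (+-*-collect (no a t) (no a u) (no b t) (no b u) _ _)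
no-subst-pair σ (bang t) a b a≢b h = no-subst-pair σ t a b a≢b h
no-subst-pair σ (letb u t) {x} a b a≢b h =
  trans (cong₂ _+_ (no-subst-pair σ u a b a≢b h)
                   (trans (no-subst-pair (exts σ) t (suc a) (suc b) (a≢b ∘ suc-injective)
                                         (apart₂-exts σ h))
                          (cong₂ _+_ (cong (no (suc a) t *_) (no-weaken (σ a) x))
                                     (cong (no (suc b) t *_) (no-weaken (σ b) x)))))
        (+-*-collect (no a u) (no (suc a) t) (no b u) (no (suc b) t) _ _)

no-[] : ∀ t u x → no x (t [ u ]) ≡ no (suc x) t + no 0 t * no x u
no-[] t u x = begin
  no x (t [ u ])
    ≡⟨ no-subst-pair (sub0 u) t (suc x) 0 (λ ()) others ⟩
  no (suc x) t * no x (var x) + no 0 t * no x u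
    ≡⟨ cong (λ k → no (suc x) t * k + no 0 t * no x u) (no-var-≡ x) ⟩
  no (suc x) t * 1 + no 0 t * no x u
    ≡⟨ cong (_+ no 0 t * no x u) (*-identityʳ (no (suc x) t)) ⟩
  no (suc x) t + no 0 t * no x u
    ∎
  where
  open ≡-Reasoning
  others : ∀ {y} → y ≢ suc x → y ≢ 0 → ¬ (x ∈FV sub0 u y)
  others {zero}  _    y≢0 _      = y≢0 refl
  others {suc y} y≢sx _   fv-var = y≢sx refl

no-0-subst-exts : ∀ σ t → no 0 (subst (exts σ) t) ≡ no 0 t
no-0-subst-exts σ t = trans (no-subst-single (exts σ) t 0 only-0) (*-identityʳ (no 0 t))
  where
  only-0 : ∀ {y} → y ∈FV t → y ≢ 0 → ¬ (0 ∈FV exts σ y)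
  only-0 {zero}  _ y≢0 = ⊥-elim (y≢0 refl)
  only-0 {suc y} _ _   = 0∉FV-weaken (σ y)

0∉TV-subst-exts : ∀ σ t → ¬ (0 ∈TV t) → ¬ (0 ∈TV subst (exts σ) t)
0∉TV-subst-exts σ t 0∉TV p with ∈TV-subst⁻ (exts σ) t p
... | inj₁ (zero  , 0∈ , _) = 0∉TV 0∈
... | inj₁ (suc y , _  , q) = 0∉FV-weaken (σ y) q
... | inj₂ (suc y , _  , q) = 0∉TV-weaken (σ y) q

-- Admissible substitutions

-- Stated for simultaneous substitutions so that it survives pushing the substitution
-- under a binder (Admissible-exts).
record Admissible (σ : ℕ → Tm) (t : Tm) : Set where
  field
    terms          : ∀ y → y ∈FV t → IsTerm (σ y)
    tv-boxable     : ∀ y → y ∈TV t → Boxable (σ y)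
    tv-apart       : ∀ y z x → y ∈TV t → z ∈FV t → y ≢ z → x ∈FV σ y → ¬ (x ∈FV σ z)
    tvImage-apart  : ∀ y z x → y ∈FV t → z ∈FV t → y ≢ z → x ∈TV σ y → ¬ (x ∈FV σ z)
    tvImage-affine : ∀ y x → y ∈FV t → x ∈TV σ y → no y t ≤ 1
open Admissible

Admissible-mono : ∀ {σ s t} → Admissible σ t → s ⊆ᵥ t → (∀ y → no y s ≤ no y t) → Admissible σ s
Admissible-mono A s⊆t no≤ = record
  { terms          = λ y p → terms A y (⊆FV s⊆t p)
  ; tv-boxable     = λ y p → tv-boxable A y (⊆TV s⊆t p)
  ; tv-apart       = λ y z x p q → tv-apart A y z x (⊆TV s⊆t p) (⊆FV s⊆t q)
  ; tvImage-apart  = λ y z x p q → tvImage-apart A y z x (⊆FV s⊆t p) (⊆FV s⊆t q)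
  ; tvImage-affine = λ y x p q → ≤-trans (no≤ y) (tvImage-affine A y x (⊆FV s⊆t p) q)
  }

Admissible-exts : ∀ {σ t} → Admissible σ (lam t) → Admissible (exts σ) t
Admissible-exts {σ} {t} A = record
  { terms = terms′ ; tv-boxable = tv-boxable′ ; tv-apart = tv-apart′
  ; tvImage-apart = tvImage-apart′ ; tvImage-affine = tvImage-affine′
  }
  where
  terms′ : ∀ y → y ∈FV t → IsTerm (exts σ y)
  terms′ zero    _ = t-var
  terms′ (suc y) p = IsTerm-rename suc-injective (terms A y (fv-lam p))

  tv-boxable′ : ∀ y → y ∈TV t → Boxable (exts σ y)
  tv-boxable′ zero    _ = Boxable-var 0
  tv-boxable′ (suc y) p = Boxable-rename suc-injective (tv-boxable A y (tv-lam p))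

  tv-apart′ : ∀ y z x → y ∈TV t → z ∈FV t → y ≢ z → x ∈FV exts σ y → ¬ (x ∈FV exts σ z)
  tv-apart′ zero    zero    _ _ _ y≢z _      _      = y≢z refl
  tv-apart′ zero    (suc z) _ _ _ _   fv-var r      = 0∉FV-weaken (σ z) r
  tv-apart′ (suc y) zero    _ _ _ _   r      fv-var = 0∉FV-weaken (σ y) r
  tv-apart′ (suc y) (suc z) _ p q y≢z r r′ with ∈FV-rename⁻ suc (σ y) r
  ... | x , x∈ , refl =
    tv-apart A y z x (tv-lam p) (fv-lam q) (y≢z ∘ cong suc) x∈ (∈FV-weaken⁻ (σ z) r′)

  tvImage-apart′ : ∀ y z x → y ∈FV t → z ∈FV t → y ≢ z → x ∈TV exts σ y → ¬ (x ∈FV exts σ z)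
  tvImage-apart′ zero    _       _ _ _ _   ()
  tvImage-apart′ (suc y) zero    _ _ _ _   r fv-var = 0∉TV-weaken (σ y) r
  tvImage-apart′ (suc y) (suc z) _ p q y≢z r r′ with ∈TV-rename⁻ suc (σ y) r
  ... | x , x∈ , refl =
    tvImage-apart A y z x (fv-lam p) (fv-lam q) (y≢z ∘ cong suc) x∈ (∈FV-weaken⁻ (σ z) r′)

  tvImage-affine′ : ∀ y x → y ∈FV t → x ∈TV exts σ y → no y t ≤ 1
  tvImage-affine′ zero    _ _ ()
  tvImage-affine′ (suc y) _ p r with ∈TV-rename⁻ suc (σ y) r
  ... | x , x∈ , refl = tvImage-affine A y x (fv-lam p) x∈

TV-subst-apart : ∀ σ {s t} → Compatible s t → Admissible σ (app s t)
               → ∀ x → x ∈TV subst σ s → ¬ (x ∈FV subst σ t)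
TV-subst-apart σ {s} {t} (tv∩fv , _) A x p q = clash (∈TV-subst⁻ σ s p) (∈FV-subst⁻ σ t q)
  where
  clash : (∃[ y ] y ∈TV s × x ∈FV σ y) ⊎ (∃[ y ] y ∈FV s × x ∈TV σ y)
        → ∃[ z ] z ∈FV t × x ∈FV σ z → ⊥
  clash (inj₁ (y , y∈ , r)) (z , z∈ , r′) with y ≟ z
  ... | yes refl = tv∩fv y y∈ z∈
  ... | no′ y≢z  = tv-apart A y z x (tv-app₁ y∈) (fv-app₂ z∈) y≢z r r′
  clash (inj₂ (y , y∈ , r)) (z , z∈ , r′) with y ≟ z
  ... | yes refl = 1+n≰n (≤-trans (∈FV-both⇒no≥2 y∈ z∈) (tvImage-affine A y x (fv-app₁ y∈) r))
  ... | no′ y≢z  = tvImage-apart A y z x (fv-app₁ y∈) (fv-app₂ z∈) y≢z r r′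

Compatible-subst : ∀ σ {s t} → Compatible s t → Admissible σ (app s t)
                 → Compatible (subst σ s) (subst σ t)
Compatible-subst σ {s} {t} c A =
  TV-subst-apart σ c A , λ x p q → TV-subst-apart σ (Compatible-sym c) A-swap x q p
  where
  A-swap : Admissible σ (app t s)
  A-swap = Admissible-mono A ⊆ᵥ-app-swap (λ y → ≤-reflexive (+-comm (no y t) (no y s)))

Boxable-subst : ∀ σ {t} → Boxable t → Admissible σ (bang t) → Boxable (subst σ t)
Boxable-subst σ {t} (no-tv , linear) A = no-tv′ , linear′
  where
  no-tv′ : ∀ x → ¬ (x ∈TV subst σ t)
  no-tv′ x p with ∈TV-subst⁻ σ t p
  ... | inj₁ (y , y∈ , _) = no-tv y y∈
  ... | inj₂ (y , y∈ , q) = proj₁ (tv-boxable A y (tv-bang y∈)) x q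

  linear′ : ∀ x → x ∈FV subst σ t → no x (subst σ t) ≡ 1
  linear′ x p with ∈FV-subst⁻ σ t p
  ... | z , z∈ , q = begin
    no x (subst σ t)     ≡⟨ no-subst-single σ t z only-z ⟩
    no z t * no x (σ z)  ≡⟨ cong₂ _*_ (linear z z∈) (proj₂ (tv-boxable A z (tv-bang z∈)) x q) ⟩
    1                    ∎
    where
    open ≡-Reasoning
    only-z : ∀ {y} → y ∈FV t → y ≢ z → ¬ (x ∈FV σ y)
    only-z y∈ y≢z r = tv-apart A _ z x (tv-bang y∈) (fv-bang z∈) y≢z r q

subst-IsTerm : ∀ σ {t} → IsTerm t → Admissible σ t → IsTerm (subst σ t)
subst-IsTerm σ {var y} t-var A = terms A y fv-var
subst-IsTerm σ {lam t} (t-lam ⊢t 0∉TV no≤1) A =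
  t-lam (subst-IsTerm (exts σ) ⊢t (Admissible-exts A))
        (0∉TV-subst-exts σ t 0∉TV)
        (≤-trans (≤-reflexive (no-0-subst-exts σ t)) no≤1)
subst-IsTerm σ (t-app ⊢s ⊢t c) A =
  t-app (subst-IsTerm σ ⊢s (Admissible-mono A ⊆ᵥ-app₁ (λ _ → m≤m+n _ _)))
        (subst-IsTerm σ ⊢t (Admissible-mono A ⊆ᵥ-app₂ (λ _ → m≤n+m _ _)))
        (Compatible-subst σ c A)
subst-IsTerm σ (t-bang ⊢t no-tv linear) A =
  IsTerm-bang (subst-IsTerm σ ⊢t (Admissible-mono A ⊆ᵥ-bang (λ _ → ≤-refl)))
              (Boxable-subst σ (no-tv , linear) A)
subst-IsTerm σ (t-let ⊢u ⊢t c) A =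
  t-let (subst-IsTerm σ ⊢u (Admissible-mono A ⊆ᵥ-let₁ (λ _ → m≤m+n _ _)))
        (subst-IsTerm (exts σ) ⊢t (Admissible-exts (Admissible-mono A ⊆ᵥ-let₂ (λ _ → m≤n+m _ _))))
        (Compatible-subst σ c (Admissible-mono A ⊆ᵥ-let-app (λ _ → ≤-refl)))

sub0-admissible : ∀ {t u} → IsTerm u → Compatible (lam t) u
                → (∀ {x} → x ∈TV u → no 0 t ≤ 1)
                → (0 ∈TV t → Boxable u × (∀ x → x ∈FV u → ¬ (x ∈FV lam t)))
                → Admissible (sub0 u) t
sub0-admissible {t} {u} ⊢u (tv∩fv , fv∩tv) affine temporary = record
  { terms = terms′ ; tv-boxable = tv-boxable′ ; tv-apart = tv-apart′
  ; tvImage-apart = tvImage-apart′ ; tvImage-affine = tvImage-affine′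
  }
  where
  terms′ : ∀ y → y ∈FV t → IsTerm (sub0 u y)
  terms′ zero    _ = ⊢u
  terms′ (suc y) _ = t-var

  tv-boxable′ : ∀ y → y ∈TV t → Boxable (sub0 u y)
  tv-boxable′ zero    p = proj₁ (temporary p)
  tv-boxable′ (suc y) _ = Boxable-var y

  tv-apart′ : ∀ y z x → y ∈TV t → z ∈FV t → y ≢ z → x ∈FV sub0 u y → ¬ (x ∈FV sub0 u z)
  tv-apart′ zero    zero    _ _ _ y≢z _      _      = y≢z refl
  tv-apart′ zero    (suc z) _ p q _   r      fv-var = proj₂ (temporary p) z r (fv-lam q)
  tv-apart′ (suc y) zero    _ p _ _   fv-var r      = tv∩fv y (tv-lam p) r
  tv-apart′ (suc y) (suc z) _ _ _ y≢z fv-var fv-var = y≢z refl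

  tvImage-apart′ : ∀ y z x → y ∈FV t → z ∈FV t → y ≢ z → x ∈TV sub0 u y → ¬ (x ∈FV sub0 u z)
  tvImage-apart′ zero    zero    _ _ _ y≢z _ _      = y≢z refl
  tvImage-apart′ zero    (suc z) _ _ q _   r fv-var = fv∩tv z (fv-lam q) r
  tvImage-apart′ (suc y) _       _ _ _ _   ()

  tvImage-affine′ : ∀ y x → y ∈FV t → x ∈TV sub0 u y → no y t ≤ 1
  tvImage-affine′ zero    _ _ r = affine r
  tvImage-affine′ (suc y) _ _ ()

β-admissible : ∀ {t u} → IsTerm (app (lam t) u) → Admissible (sub0 u) t
β-admissible (t-app (t-lam _ 0∉TV no≤1) ⊢u c) =
  sub0-admissible ⊢u c (λ _ → no≤1) (⊥-elim ∘ 0∉TV)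

!-admissible : ∀ {t u} → IsTerm (letb (bang u) t) → Admissible (sub0 u) t
!-admissible (t-let (t-bang ⊢u no-tv linear) _ c) =
  sub0-admissible ⊢u (Compatible-sym (Compatible-mono ⊆ᵥ-bang ⊆ᵥ-refl c))
                  (λ {x} p → ⊥-elim (no-tv x p))
                  (λ _ → (no-tv , linear) , λ x p q → proj₁ c x (tv-bang p) q)

-- Reduction

⟶-∈FV⁻ : ∀ {t t′} → t ⟶ t′ → ∀ {x} → x ∈FV t′ → x ∈FV t
⟶-∈FV⁻ (β {t} {u}) p with ∈FV-subst⁻ (sub0 u) t p
... | zero  , _  , q      = fv-app₂ q
... | suc y , y∈ , fv-var = fv-app₁ (fv-lam y∈)
⟶-∈FV⁻ (bangR {u} {t}) p with ∈FV-subst⁻ (sub0 u) t p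
... | zero  , _  , q      = fv-let₁ (fv-bang q)
... | suc y , y∈ , fv-var = fv-let₂ y∈
⟶-∈FV⁻ com1 (fv-let₁ p)           = fv-let₁ (fv-let₁ p)
⟶-∈FV⁻ com1 (fv-let₂ (fv-let₁ p)) = fv-let₁ (fv-let₂ p)
⟶-∈FV⁻ (com1 {t₃ = t₃}) (fv-let₂ (fv-let₂ p)) =
  fv-let₂ (∈FV-rename-injective⁻ ext-suc-injective t₃ p)
⟶-∈FV⁻ com2 (fv-let₁ p)           = fv-app₁ (fv-let₁ p)
⟶-∈FV⁻ com2 (fv-let₂ (fv-app₁ p)) = fv-app₁ (fv-let₂ p)
⟶-∈FV⁻ (com2 {t₃ = t₃}) (fv-let₂ (fv-app₂ p)) = fv-app₂ (∈FV-weaken⁻ t₃ p)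
⟶-∈FV⁻ (c-lam r)  (fv-lam p)  = fv-lam (⟶-∈FV⁻ r p)
⟶-∈FV⁻ (c-app₁ r) (fv-app₁ p) = fv-app₁ (⟶-∈FV⁻ r p)
⟶-∈FV⁻ (c-app₁ r) (fv-app₂ p) = fv-app₂ p
⟶-∈FV⁻ (c-app₂ r) (fv-app₁ p) = fv-app₁ p
⟶-∈FV⁻ (c-app₂ r) (fv-app₂ p) = fv-app₂ (⟶-∈FV⁻ r p)
⟶-∈FV⁻ (c-bang r) (fv-bang p) = fv-bang (⟶-∈FV⁻ r p)
⟶-∈FV⁻ (c-let₁ r) (fv-let₁ p) = fv-let₁ (⟶-∈FV⁻ r p)
⟶-∈FV⁻ (c-let₁ r) (fv-let₂ p) = fv-let₂ p
⟶-∈FV⁻ (c-let₂ r) (fv-let₁ p) = fv-let₁ p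
⟶-∈FV⁻ (c-let₂ r) (fv-let₂ p) = fv-let₂ (⟶-∈FV⁻ r p)

⟶-∈TV⁻ : ∀ {t t′} → IsTerm t → t ⟶ t′ → ∀ {x} → x ∈TV t′ → x ∈TV t
⟶-∈TV⁻ (t-app (t-lam _ 0∉TV _) _ _) (β {t} {u}) p with ∈TV-subst⁻ (sub0 u) t p
... | inj₁ (zero  , 0∈ , _)      = ⊥-elim (0∉TV 0∈)
... | inj₁ (suc y , y∈ , fv-var) = tv-app₁ (tv-lam y∈)
... | inj₂ (zero  , _  , q)      = tv-app₂ q
⟶-∈TV⁻ _ (bangR {u} {t}) p with ∈TV-subst⁻ (sub0 u) t p
... | inj₁ (zero  , _  , q)      = tv-let₁ (tv-bang q)
... | inj₁ (suc y , y∈ , fv-var) = tv-let₂ y∈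
... | inj₂ (zero  , _  , q)      = tv-let₁ (tv-bang (∈TV⇒∈FV q))
⟶-∈TV⁻ _ com1 (tv-let₁ p)           = tv-let₁ (tv-let₁ p)
⟶-∈TV⁻ _ com1 (tv-let₂ (tv-let₁ p)) = tv-let₁ (tv-let₂ p)
⟶-∈TV⁻ _ (com1 {t₃ = t₃}) (tv-let₂ (tv-let₂ p)) =
  tv-let₂ (∈TV-rename-injective⁻ ext-suc-injective t₃ p)
⟶-∈TV⁻ _ com2 (tv-let₁ p)           = tv-app₁ (tv-let₁ p)
⟶-∈TV⁻ _ com2 (tv-let₂ (tv-app₁ p)) = tv-app₁ (tv-let₂ p)
⟶-∈TV⁻ _ (com2 {t₃ = t₃}) (tv-let₂ (tv-app₂ p)) = tv-app₂ (∈TV-weaken⁻ t₃ p)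
⟶-∈TV⁻ (t-lam ⊢t _ _)  (c-lam r)  (tv-lam p)  = tv-lam (⟶-∈TV⁻ ⊢t r p)
⟶-∈TV⁻ (t-app ⊢t _ _)  (c-app₁ r) (tv-app₁ p) = tv-app₁ (⟶-∈TV⁻ ⊢t r p)
⟶-∈TV⁻ _               (c-app₁ r) (tv-app₂ p) = tv-app₂ p
⟶-∈TV⁻ _               (c-app₂ r) (tv-app₁ p) = tv-app₁ p
⟶-∈TV⁻ (t-app _ ⊢u _)  (c-app₂ r) (tv-app₂ p) = tv-app₂ (⟶-∈TV⁻ ⊢u r p)
⟶-∈TV⁻ _               (c-bang r) (tv-bang p) = tv-bang (⟶-∈FV⁻ r p)
⟶-∈TV⁻ (t-let ⊢u _ _)  (c-let₁ r) (tv-let₁ p) = tv-let₁ (⟶-∈TV⁻ ⊢u r p)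
⟶-∈TV⁻ _               (c-let₁ r) (tv-let₂ p) = tv-let₂ p
⟶-∈TV⁻ _               (c-let₂ r) (tv-let₁ p) = tv-let₁ p
⟶-∈TV⁻ (t-let _ ⊢t _)  (c-let₂ r) (tv-let₂ p) = tv-let₂ (⟶-∈TV⁻ ⊢t r p)

⟶-⊆ᵥ : ∀ {t t′} → IsTerm t → t ⟶ t′ → t′ ⊆ᵥ t
⟶-⊆ᵥ ⊢t r = record { ⊆FV = ⟶-∈FV⁻ r ; ⊆TV = ⟶-∈TV⁻ ⊢t r }

⟶-no-≤ : ∀ {t t′} → IsTerm t → t ⟶ t′ → ∀ x → ¬ (x ∈TV t) → no x t′ ≤ no x t
⟶-no-≤ (t-app (t-lam _ _ no≤1) _ _) (β {t} {u}) x _ = begin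
  no x (t [ u ])                  ≡⟨ no-[] t u x ⟩
  no (suc x) t + no 0 t * no x u  ≤⟨ +-monoʳ-≤ (no (suc x) t) (*-monoˡ-≤ (no x u) no≤1) ⟩
  no (suc x) t + 1 * no x u       ≡⟨ cong (no (suc x) t +_) (*-identityˡ (no x u)) ⟩
  no (suc x) t + no x u           ∎
  where open ≤-Reasoning
⟶-no-≤ _ (bangR {u} {t}) x x∉TV = begin
  no x (t [ u ])                  ≡⟨ no-[] t u x ⟩
  no (suc x) t + no 0 t * no x u  ≡⟨ cong (λ k → no (suc x) t + no 0 t * k) no-x-u≡0 ⟩
  no (suc x) t + no 0 t * 0       ≡⟨ cong (no (suc x) t +_) (*-zeroʳ (no 0 t)) ⟩
  no (suc x) t + 0                ≡⟨ +-identityʳ (no (suc x) t) ⟩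
  no (suc x) t                    ≤⟨ m≤n+m (no (suc x) t) (no x u) ⟩
  no x u + no (suc x) t           ∎
  where
  open ≤-Reasoning
  no-x-u≡0 : no x u ≡ 0
  no-x-u≡0 = ∉FV⇒no≡0 u (x∉TV ∘ tv-let₁ ∘ tv-bang)
⟶-no-≤ _ (com1 {t₁} {t₂} {t₃}) x _ = ≤-reflexive (begin
  no x t₁ + (no (suc x) t₂ + no (suc (suc x)) (rename (ext suc) t₃))
    ≡⟨ cong (λ k → no x t₁ + (no (suc x) t₂ + k)) (no-rename ext-suc-injective t₃ (suc x)) ⟩
  no x t₁ + (no (suc x) t₂ + no (suc x) t₃)
    ≡⟨ +-assoc (no x t₁) (no (suc x) t₂) (no (suc x) t₃) ⟨
  no x t₁ + no (suc x) t₂ + no (suc x) t₃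
    ∎)
  where open ≡-Reasoning
⟶-no-≤ _ (com2 {t₁} {t₂} {t₃}) x _ = ≤-reflexive (begin
  no x t₁ + (no (suc x) t₂ + no (suc x) (rename suc t₃))
    ≡⟨ cong (λ k → no x t₁ + (no (suc x) t₂ + k)) (no-weaken t₃ x) ⟩
  no x t₁ + (no (suc x) t₂ + no x t₃)
    ≡⟨ +-assoc (no x t₁) (no (suc x) t₂) (no x t₃) ⟨
  no x t₁ + no (suc x) t₂ + no x t₃
    ∎)
  where open ≡-Reasoning
⟶-no-≤ (t-lam ⊢t _ _) (c-lam r) x x∉TV = ⟶-no-≤ ⊢t r (suc x) (x∉TV ∘ tv-lam)
⟶-no-≤ (t-app {u = u} ⊢t _ _) (c-app₁ r) x x∉TV =
  +-monoˡ-≤ (no x u) (⟶-no-≤ ⊢t r x (x∉TV ∘ tv-app₁))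
⟶-no-≤ (t-app {t = t} _ ⊢u _) (c-app₂ r) x x∉TV =
  +-monoʳ-≤ (no x t) (⟶-no-≤ ⊢u r x (x∉TV ∘ tv-app₂))
⟶-no-≤ _ (c-bang {t' = t′} r) x x∉TV =
  ≤-trans (≤-reflexive (∉FV⇒no≡0 t′ (x∉TV ∘ tv-bang ∘ ⟶-∈FV⁻ r))) z≤n
⟶-no-≤ (t-let {t = t} ⊢u _ _) (c-let₁ r) x x∉TV =
  +-monoˡ-≤ (no (suc x) t) (⟶-no-≤ ⊢u r x (x∉TV ∘ tv-let₁))
⟶-no-≤ (t-let {u = u} _ ⊢t _) (c-let₂ r) x x∉TV =
  +-monoʳ-≤ (no x u) (⟶-no-≤ ⊢t r (suc x) (x∉TV ∘ tv-let₂))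

⟶-Boxable : ∀ {t t′} → IsTerm t → t ⟶ t′ → Boxable t → Boxable t′
⟶-Boxable {t} {t′} ⊢t r (no-tv , linear) = (λ x → no-tv x ∘ ⟶-∈TV⁻ ⊢t r) , linear′
  where
  linear′ : ∀ x → x ∈FV t′ → no x t′ ≡ 1
  linear′ x p = ≤-antisym (≤-trans (⟶-no-≤ ⊢t r x (no-tv x)) (≤-reflexive (linear x (⟶-∈FV⁻ r p))))
                          (∈FV⇒no≥1 p)

⟶-IsTerm : ∀ {t t′} → IsTerm t → t ⟶ t′ → IsTerm t′
⟶-IsTerm ⊢r@(t-app (t-lam ⊢t _ _) _ _) β     = subst-IsTerm _ ⊢t (β-admissible ⊢r)
⟶-IsTerm ⊢r@(t-let _ ⊢t _)            bangR = subst-IsTerm _ ⊢t (!-admissible ⊢r)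
⟶-IsTerm (t-let (t-let ⊢t₁ ⊢t₂ c₁₂) ⊢t₃ c) com1 =
  t-let ⊢t₁ (t-let ⊢t₂ (IsTerm-rename ext-suc-injective ⊢t₃)
                       (Compatible-weaken (Compatible-mono ⊆ᵥ-let₂ ⊆ᵥ-refl c)))
        (Compatible-mono ⊆ᵥ-refl ⊆ᵥ-com1 (Compatible-app c₁₂ (Compatible-mono ⊆ᵥ-let₁ ⊆ᵥ-refl c)))
⟶-IsTerm (t-app (t-let ⊢t₁ ⊢t₂ c₁₂) ⊢t₃ c) com2 =
  t-let ⊢t₁ (t-app ⊢t₂ (IsTerm-rename suc-injective ⊢t₃)
                       (Compatible-weaken (Compatible-mono ⊆ᵥ-let₂ ⊆ᵥ-refl c)))
        (Compatible-mono ⊆ᵥ-refl ⊆ᵥ-com2 (Compatible-app c₁₂ (Compatible-mono ⊆ᵥ-let₁ ⊆ᵥ-refl c)))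
⟶-IsTerm (t-lam ⊢t 0∉TV no≤1) (c-lam r) =
  t-lam (⟶-IsTerm ⊢t r) (0∉TV ∘ ⟶-∈TV⁻ ⊢t r) (≤-trans (⟶-no-≤ ⊢t r 0 0∉TV) no≤1)
⟶-IsTerm (t-app ⊢t ⊢u c) (c-app₁ r) =
  t-app (⟶-IsTerm ⊢t r) ⊢u (Compatible-mono (⟶-⊆ᵥ ⊢t r) ⊆ᵥ-refl c)
⟶-IsTerm (t-app ⊢t ⊢u c) (c-app₂ r) =
  t-app ⊢t (⟶-IsTerm ⊢u r) (Compatible-mono ⊆ᵥ-refl (⟶-⊆ᵥ ⊢u r) c)
⟶-IsTerm (t-bang ⊢t no-tv linear) (c-bang r) =
  IsTerm-bang (⟶-IsTerm ⊢t r) (⟶-Boxable ⊢t r (no-tv , linear))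
⟶-IsTerm (t-let ⊢u ⊢t c) (c-let₁ r) =
  t-let (⟶-IsTerm ⊢u r) ⊢t (Compatible-mono (⟶-⊆ᵥ ⊢u r) ⊆ᵥ-refl c)
⟶-IsTerm (t-let ⊢u ⊢t c) (c-let₂ r) =
  t-let ⊢u (⟶-IsTerm ⊢t r) (Compatible-mono ⊆ᵥ-refl (⊆ᵥ-lam (⟶-⊆ᵥ ⊢t r)) c)

mainTheorem13 : (∀ {t t'} → IsTerm t → t ⟶ t' → IsTerm t')
                × (∀ {t t'} → WellFormed t → t ⟶ t' → WellFormed t')
mainTheorem13 = ⟶-IsTerm , λ (⊢t , boxable) r → ⟶-IsTerm ⊢t r , ⟶-Boxable ⊢t r boxable
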